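{- Let $\phi$, $\Xi$, $\flat$ and $\mathcal{N}$ be as in the context, and let $\mathcal{C}$ be any set of clauses. Then: (1) if $\chi_1\land\chi_2\in\Xi$: $\mathcal{C}\cup\mathcal{N}\vdash\flat(\chi_1\land\chi_2)$ iff $\mathcal{C}\cup\mathcal{N}\vdash\flat\chi_1\land\flat\chi_2$; (2) if $\chi_1\lor\chi_2\in\Xi$: $\mathcal{C}\cup\mathcal{N}\vdash\flat(\chi_1\lor\chi_2)$ iff $\mathcal{C}\cup\mathcal{N}\vdash(\flat\chi_1\to x)\land(\flat\chi_2\to x)\to x$ for every $x\in\mathbb{B}$; (3) if $\chi_1\to\chi_2\in\Xi$: $\mathcal{C}\cup\mathcal{N}\vdash\flat(\chi_1\to\chi_2)$ iff $\mathcal{C}\cup\mathcal{N}\cup\{\flat\chi_1\}\vdash\flat\chi_2$; (4) $\mathcal{C}\cup\mathcal{N}\vdash\flat\bot$ iff $\mathcal{C}\cup\mathcal{N}\vdash x$ for every $x\in\mathbb{B}$.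
   Context: Let $\mathbb{B}$ be the set of basic sentences (propositional atoms other than $\bot$); formulas are built from $\mathbb{B}$ and $\bot$ with $\to,\land,\lor$. For a set of formulas $S$ and formula $\psi$, $S\vdash\psi$ means $\psi$ is derivable in intuitionistic propositional logic from hypotheses in $S$. A clause is a formula of one of the forms $(p\to q^*)\to r$, $p\to(q\lor r)$, $(p_1\land\dots\land p_n)\to q^*$ with $p,q,r,p_i\in\mathbb{B}$ and $q^*\in\mathbb{B}\cup\{\bot\}$ (the case $n=0$ meaning $q^*$ itself). Fix a formula $\phi$ and let $\Xi$ be the set of its subformulas. Fix an injection $\flat:\Xi\cup\{\bot\}\to\mathbb{B}$ with $\flat p=p$ for $p\in\Xi\cap\mathbb{B}$. For $\chi\in\Xi$: $\mathcal{M}_{\mathbb{B}}(\chi)=\emptyset$ if $\chi$ is atomic; $\mathcal{M}_{\mathbb{B}}(\chi_1\land\chi_2)=\{\flat(\chi_1\land\chi_2)\to\flat\chi_1,\ \flat(\chi_1\land\chi_2)\to\flat\chi_2,\ \flat\chi_1\land\flat\chi_2\to\flat(\chi_1\land\chi_2)\}$; $\mathcal{M}_{\mathbb{B}}(\chi_1\lor\chi_2)=\{\flat\chi_1\to\flat(\chi_1\lor\chi_2),\ \flat\chi_2\to\flat(\chi_1\lor\chi_2)\}\cup\{\flat(\chi_1\lor\chi_2)\land(\flat\chi_1\to x)\land(\flat\chi_2\to x)\to x\mid x\in\mathbb{B}\}$; $\mathcal{M}_{\mathbb{B}}(\chi_1\to\chi_2)=\{\flat(\chi_1\to\chi_2)\land\flat\chi_1\to\flat\chi_2,\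 (\flat\chi_1\to\flat\chi_2)\to\flat(\chi_1\to\chi_2)\}$. Set $\mathcal{N}:=\bigcup_{\chi\in\Xi}\mathcal{M}_{\mathbb{B}}(\chi)\cup\{\flat\bot\to x\mid x\in\mathbb{B}\}$. -}

module Defs where

open import Data.List using (List; []; _∷_)
open import Data.Sum using (_⊎_)
open import Data.Product using (_×_; Σ)
open import Relation.Binary.PropositionalEquality using (_≡_)

infixr 6 _∧_
infixr 5 _∨_
infixr 4 _⇒_

data Formula (Atom : Set) : Set where
  atom : Atom → Formula Atom
  ⊥'   : Formula Atom
  _⇒_  : Formula Atom → Formula Atom → Formula Atom
  _∧_  : Formula Atom → Formula Atom → Formula Atom
  _∨_  : Formula Atom → Formula Atom → Formula Atom

FSet : Set → Set₁
FSet Atom = Formula Atom → Set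

_∪_ : {Atom : Set} → FSet Atom → FSet Atom → FSet Atom
(S ∪ T) ψ = S ψ ⊎ T ψ

｛_｝ : {Atom : Set} → Formula Atom → FSet Atom
｛ A ｝ ψ = ψ ≡ A

infix 2 _⊢_
data _⊢_ {Atom : Set} (S : FSet Atom) : Formula Atom → Set where
  hyp  : ∀ {A} → S A → S ⊢ A
  ⊥E   : ∀ {A} → S ⊢ ⊥' → S ⊢ A
  ⇒I   : ∀ {A B} → (S ∪ ｛ A ｝) ⊢ B → S ⊢ A ⇒ B
  ⇒E   : ∀ {A B} → S ⊢ A ⇒ B → S ⊢ A → S ⊢ B
  ∧I   : ∀ {A B} → S ⊢ A → S ⊢ B → S ⊢ A ∧ B
  ∧E₁  : ∀ {A B} → S ⊢ A ∧ B → S ⊢ A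
  ∧E₂  : ∀ {A B} → S ⊢ A ∧ B → S ⊢ B
  ∨I₁  : ∀ {A B} → S ⊢ A → S ⊢ A ∨ B
  ∨I₂  : ∀ {A B} → S ⊢ B → S ⊢ A ∨ B
  ∨E   : ∀ {A B C} → S ⊢ A ∨ B → (S ∪ ｛ A ｝) ⊢ C → (S ∪ ｛ B ｝) ⊢ C → S ⊢ C

-- Subformula relation (reflexive).  `Sub χ φ` : χ ∈ Ξ (subformulas of φ).
data Sub {Atom : Set} : Formula Atom → Formula Atom → Set where
  here   : ∀ {φ} → Sub φ φ
  ⇒l : ∀ {χ A B} → Sub χ A → Sub χ (A ⇒ B)
  ⇒r : ∀ {χ A B} → Sub χ B → Sub χ (A ⇒ B)
  ∧l : ∀ {χ A B} → Sub χ A → Sub χ (A ∧ B)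
  ∧r : ∀ {χ A B} → Sub χ B → Sub χ (A ∧ B)
  ∨l : ∀ {χ A B} → Sub χ A → Sub χ (A ∨ B)
  ∨r : ∀ {χ A B} → Sub χ B → Sub χ (A ∨ B)

data AtomOrBot {Atom : Set} : Formula Atom → Set where
  isAtom : ∀ p → AtomOrBot (atom p)
  isBot  : AtomOrBot ⊥'

conj : {Atom : Set} → Atom → List Atom → Formula Atom
conj p []       = atom p
conj p (q ∷ ps) = atom p ∧ conj q ps

horn : {Atom : Set} → List Atom → Formula Atom → Formula Atom
horn []       q = q
horn (p ∷ ps) q = conj p ps ⇒ q

data IsClause {Atom : Set} : Formula Atom → Set where
  impClause  : ∀ (p : Atom) {q} (r : Atom) → AtomOrBot q →
               IsClause ((atom p ⇒ q) ⇒ atom r)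
  disjClause : ∀ (p q r : Atom) → IsClause (atom p ⇒ (atom q ∨ atom r))
  hornClause : ∀ (ps : List Atom) {q} → AtomOrBot q → IsClause (horn ps q)

-- ♭ is given as a total function, required (in the statement) to be
-- injective on Ξ ∪ {⊥} and to fix the atoms of Ξ.
module _ {Atom : Set} (♭ : Formula Atom → Atom) where

  ♭' : Formula Atom → Formula Atom
  ♭' χ = atom (♭ χ)

  data M : Formula Atom → FSet Atom where
    ∧-1 : ∀ {χ₁ χ₂} → M (χ₁ ∧ χ₂) (♭' (χ₁ ∧ χ₂) ⇒ ♭' χ₁)
    ∧-2 : ∀ {χ₁ χ₂} → M (χ₁ ∧ χ₂) (♭' (χ₁ ∧ χ₂) ⇒ ♭' χ₂)
    ∧-3 : ∀ {χ₁ χ₂} → M (χ₁ ∧ χ₂) (♭' χ₁ ∧ ♭' χ₂ ⇒ ♭' (χ₁ ∧ χ₂))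
    ∨-1 : ∀ {χ₁ χ₂} → M (χ₁ ∨ χ₂) (♭' χ₁ ⇒ ♭' (χ₁ ∨ χ₂))
    ∨-2 : ∀ {χ₁ χ₂} → M (χ₁ ∨ χ₂) (♭' χ₂ ⇒ ♭' (χ₁ ∨ χ₂))
    ∨-3 : ∀ {χ₁ χ₂} (x : Atom) →
          M (χ₁ ∨ χ₂) (♭' (χ₁ ∨ χ₂) ∧ (♭' χ₁ ⇒ atom x) ∧ (♭' χ₂ ⇒ atom x) ⇒ atom x)
    ⇒-1 : ∀ {χ₁ χ₂} → M (χ₁ ⇒ χ₂) (♭' (χ₁ ⇒ χ₂) ∧ ♭' χ₁ ⇒ ♭' χ₂)
    ⇒-2 : ∀ {χ₁ χ₂} → M (χ₁ ⇒ χ₂) ((♭' χ₁ ⇒ ♭' χ₂) ⇒ ♭' (χ₁ ⇒ χ₂))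

  data N (φ : Formula Atom) : FSet Atom where
    fromM : ∀ {χ ψ} → Sub χ φ → M χ ψ → N φ ψ
    fromBot : (x : Atom) → N φ (♭' ⊥' ⇒ atom x)

InjectiveOnΞ⊥ : {Atom : Set} → Formula Atom → (Formula Atom → Atom) → Set
InjectiveOnΞ⊥ φ ♭ = ∀ {χ χ'} → (Sub χ φ ⊎ χ ≡ ⊥') → (Sub χ' φ ⊎ χ' ≡ ⊥') →
                    ♭ χ ≡ ♭ χ' → χ ≡ χ'

FixesAtoms : {Atom : Set} → Formula Atom → (Formula Atom → Atom) → Set
FixesAtoms φ ♭ = ∀ p → Sub (atom p) φ → ♭ (atom p) ≡ p

module Submission where

open import Defs
open import Data.Product using (_×_; _,_)
open import Data.Sum using (inj₁; inj₂; map₁)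
open import Function.Bundles using (_⇔_; mk⇔)
open import Function.Construct.Composition using (_⇔-∘_)
open import Function.Construct.Symmetry using (⇔-sym)
open import Relation.Binary.PropositionalEquality using (refl)

-- Each equivalence is forced by the axioms 𝓜_𝔹 and {♭⊥ → x} alone: they make
-- ♭χ interderivable with the formula built from the ♭χᵢ by χ's main connective.

private variable
  Atom : Set
  S T : FSet Atom
  A B D : Formula Atom

⊢-mono : (∀ {ψ} → S ψ → T ψ) → S ⊢ A → T ⊢ A
⊢-mono S⊆T (hyp h)    = hyp (S⊆T h)
⊢-mono S⊆T (⊥E d)     = ⊥E (⊢-mono S⊆T d)
⊢-mono S⊆T (⇒I d)     = ⇒I (⊢-mono (map₁ S⊆T) d)
⊢-mono S⊆T (⇒E d e)   = ⇒E (⊢-mono S⊆T d) (⊢-mono S⊆T e)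
⊢-mono S⊆T (∧I d e)   = ∧I (⊢-mono S⊆T d) (⊢-mono S⊆T e)
⊢-mono S⊆T (∧E₁ d)    = ∧E₁ (⊢-mono S⊆T d)
⊢-mono S⊆T (∧E₂ d)    = ∧E₂ (⊢-mono S⊆T d)
⊢-mono S⊆T (∨I₁ d)    = ∨I₁ (⊢-mono S⊆T d)
⊢-mono S⊆T (∨I₂ d)    = ∨I₂ (⊢-mono S⊆T d)
⊢-mono S⊆T (∨E d e f) = ∨E (⊢-mono S⊆T d) (⊢-mono (map₁ S⊆T) e) (⊢-mono (map₁ S⊆T) f)

⊢-weaken : S ⊢ A → (S ∪ T) ⊢ A
⊢-weaken = ⊢-mono inj₁

⊢-assumption : (S ∪ ｛ A ｝) ⊢ A
⊢-assumption = hyp (inj₂ refl)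

deduction : ((S ∪ ｛ A ｝) ⊢ B) ⇔ (S ⊢ A ⇒ B)
deduction = mk⇔ ⇒I (λ d → ⇒E (⊢-weaken d) ⊢-assumption)

⇒-curry : S ⊢ A ∧ B ⇒ D → S ⊢ A ⇒ B ⇒ D
⇒-curry d = ⇒I (⇒I (⇒E (⊢-weaken (⊢-weaken d)) (∧I (⊢-weaken ⊢-assumption) ⊢-assumption)))

⇒-pair : S ⊢ D ⇒ A → S ⊢ D ⇒ B → S ⊢ D ⇒ A ∧ B
⇒-pair d e = ⇒I (∧I (⇒E (⊢-weaken d) ⊢-assumption) (⇒E (⊢-weaken e) ⊢-assumption))

⊢-interderivable : S ⊢ A ⇒ B → S ⊢ B ⇒ A → (S ⊢ A) ⇔ (S ⊢ B)
⊢-interderivable A⇒B B⇒A = mk⇔ (⇒E A⇒B) (⇒E B⇒A)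

⊢-∧-iff : S ⊢ D ⇒ A → S ⊢ D ⇒ B → S ⊢ A ∧ B ⇒ D → (S ⊢ D) ⇔ (S ⊢ A ∧ B)
⊢-∧-iff D⇒A D⇒B A∧B⇒D = ⊢-interderivable (⇒-pair D⇒A D⇒B) A∧B⇒D

⊢-⇒-iff : S ⊢ D ∧ A ⇒ B → S ⊢ (A ⇒ B) ⇒ D → (S ⊢ D) ⇔ ((S ∪ ｛ A ｝) ⊢ B)
⊢-⇒-iff D∧A⇒B A⇒B⇒D = ⇔-sym deduction ⇔-∘ ⊢-interderivable (⇒-curry D∧A⇒B) A⇒B⇒D

-- The converse instantiates the atomic second-order disjunction at x := d itself.
⊢-∨-iff : ∀ {d} → S ⊢ A ⇒ atom d → S ⊢ B ⇒ atom d →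
  (∀ x → S ⊢ atom d ∧ (A ⇒ atom x) ∧ (B ⇒ atom x) ⇒ atom x) →
  (S ⊢ atom d) ⇔ (∀ x → S ⊢ (A ⇒ atom x) ∧ (B ⇒ atom x) ⇒ atom x)
⊢-∨-iff {d = d} A⇒d B⇒d elim =
  mk⇔ (λ ⊢d x → ⇒E (⇒-curry (elim x)) ⊢d)
      (λ ⊢elim → ⇒E (⊢elim d) (∧I A⇒d B⇒d))

⊢-explosive-iff : ∀ {d} → (∀ x → S ⊢ atom d ⇒ atom x) →
  (S ⊢ atom d) ⇔ (∀ x → S ⊢ atom x)
⊢-explosive-iff {d = d} d⇒x = mk⇔ (λ ⊢d x → ⇒E (d⇒x x) ⊢d) (λ ⊢x → ⊢x d)

lemma4p3 : {Atom : Set} (φ : Formula Atom) (♭ : Formula Atom → Atom) →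
    InjectiveOnΞ⊥ φ ♭ → FixesAtoms φ ♭ →
    (C : FSet Atom) → (∀ ψ → C ψ → IsClause ψ) →
    ((∀ χ₁ χ₂ → Sub (χ₁ ∧ χ₂) φ →
        ((C ∪ N ♭ φ) ⊢ ♭' ♭ (χ₁ ∧ χ₂)) ⇔ ((C ∪ N ♭ φ) ⊢ ♭' ♭ χ₁ ∧ ♭' ♭ χ₂))
    × (∀ χ₁ χ₂ → Sub (χ₁ ∨ χ₂) φ →
        ((C ∪ N ♭ φ) ⊢ ♭' ♭ (χ₁ ∨ χ₂))
          ⇔ (∀ (x : Atom) → (C ∪ N ♭ φ) ⊢ (♭' ♭ χ₁ ⇒ atom x) ∧ (♭' ♭ χ₂ ⇒ atom x) ⇒ atom x))
    × (∀ χ₁ χ₂ → Sub (χ₁ ⇒ χ₂) φ →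
        ((C ∪ N ♭ φ) ⊢ ♭' ♭ (χ₁ ⇒ χ₂)) ⇔ (((C ∪ N ♭ φ) ∪ ｛ ♭' ♭ χ₁ ｝) ⊢ ♭' ♭ χ₂))
    × (((C ∪ N ♭ φ) ⊢ ♭' ♭ ⊥') ⇔ (∀ (x : Atom) → (C ∪ N ♭ φ) ⊢ atom x)))
lemma4p3 φ ♭ _ _ C _ =
    (λ _ _ s → ⊢-∧-iff (M-axiom s ∧-1) (M-axiom s ∧-2) (M-axiom s ∧-3))
  , (λ _ _ s → ⊢-∨-iff (M-axiom s ∨-1) (M-axiom s ∨-2) (λ x → M-axiom s (∨-3 x)))
  , (λ _ _ s → ⊢-⇒-iff (M-axiom s ⇒-1) (M-axiom s ⇒-2))
  , ⊢-explosive-iff (λ x → hyp (inj₂ (fromBot x)))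
  where
    M-axiom : ∀ {χ ψ} → Sub χ φ → M ♭ χ ψ → (C ∪ N ♭ φ) ⊢ ψ
    M-axiom s m = hyp (inj₂ (fromM s m))
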